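{- Let $\epsilon:A\otimes B\to 0$ be a dual pairing in a symmetric monoidal category and let $\mu_A:A\otimes A\to A$ be a magma structure on $A$, with induced maps $\lhd: A\otimes B\to B$ and $\rhd: B\otimes A\to B$. Then: (1) $\epsilon\circ(A\otimes\rhd)=\epsilon\circ\sigma_{B,A}\circ(\lhd\otimes A)$ as maps $A\otimes B\otimes A\to 0$. (2) If $\mu_A$ is associative, then $\lhd$ is a left action, i.e. $\lhd\circ(\mu_A\otimes B)=\lhd\circ(A\otimes\lhd)$, and $\rhd$ is a right action, i.e. $\rhd\circ(B\otimes\mu_A)=\rhd\circ(\rhd\otimes A)$. (3) If $\mu_A$ is associative, then $\lhd\circ(A\otimes\rhd)=\rhd\circ(\lhd\otimes A)$ as maps $A\otimes B\otimes A\to B$.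
   Context: $\mathcal{V}$ is taken strict with symmetry $\sigma$; $0$ is a fixed object. A dual pairing is $\epsilon:A\otimes B\to 0$ such that for all $X$ the maps $\hom(X,B)\to\hom(A\otimes X,0)$, $f\mapsto\epsilon\circ(A\otimes f)$, and $\hom(X,A)\to\hom(X\otimes B,0)$, $g\mapsto\epsilon\circ(g\otimes B)$, are bijections. Given a magma $(A,\mu_A)$, $\lhd:A\otimes B\to B$ is the unique map with $\epsilon\circ(A\otimes\lhd)=\epsilon\circ(\mu_A\otimes B)$ (maps $A\otimes A\otimes B\to 0$), and $\rhd:B\otimes A\to B$ is the unique map with $\epsilon\circ(A\otimes\rhd)=\epsilon\circ(\mu_A\otimes B)\circ\sigma_{A\otimes B,A}$ (maps $A\otimes B\otimes A\to 0$). -}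

module Defs where

open import Level using (Level; _⊔_; suc)
open import Relation.Binary using (IsEquivalence)
open import Data.Product using (Σ; _×_; _,_)

record SymMonCat (o ℓ e : Level) : Set (suc (o ⊔ ℓ ⊔ e)) where
  infixr 9 _∘_
  infixr 10 _⊗₀_ _⊗₁_
  infix 4 _≈_
  field
    Obj   : Set o
    _⇒_   : Obj → Obj → Set ℓ
    _≈_   : ∀ {X Y} → X ⇒ Y → X ⇒ Y → Set e
    ≈-equiv : ∀ {X Y} → IsEquivalence (_≈_ {X} {Y})
    id    : ∀ {X} → X ⇒ X
    _∘_   : ∀ {X Y Z} → Y ⇒ Z → X ⇒ Y → X ⇒ Z
    assoc : ∀ {W X Y Z} {f : W ⇒ X} {g : X ⇒ Y} {h : Y ⇒ Z} →
            (h ∘ g) ∘ f ≈ h ∘ (g ∘ f)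
    identityˡ : ∀ {X Y} {f : X ⇒ Y} → id ∘ f ≈ f
    identityʳ : ∀ {X Y} {f : X ⇒ Y} → f ∘ id ≈ f
    ∘-resp-≈ : ∀ {X Y Z} {f f′ : Y ⇒ Z} {g g′ : X ⇒ Y} →
               f ≈ f′ → g ≈ g′ → f ∘ g ≈ f′ ∘ g′
    _⊗₀_ : Obj → Obj → Obj
    _⊗₁_ : ∀ {X Y X′ Y′} → X ⇒ X′ → Y ⇒ Y′ → (X ⊗₀ Y) ⇒ (X′ ⊗₀ Y′)
    ⊗-id : ∀ {X Y} → id {X} ⊗₁ id {Y} ≈ id
    ⊗-∘  : ∀ {X Y Z X′ Y′ Z′} {f : X ⇒ Y} {g : Y ⇒ Z} {f′ : X′ ⇒ Y′} {g′ : Y′ ⇒ Z′} →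
           (g ∘ f) ⊗₁ (g′ ∘ f′) ≈ (g ⊗₁ g′) ∘ (f ⊗₁ f′)
    ⊗-resp-≈ : ∀ {X Y X′ Y′} {f g : X ⇒ Y} {f′ g′ : X′ ⇒ Y′} →
               f ≈ g → f′ ≈ g′ → f ⊗₁ f′ ≈ g ⊗₁ g′
    I : Obj
    α⇒ : ∀ {X Y Z} → ((X ⊗₀ Y) ⊗₀ Z) ⇒ (X ⊗₀ (Y ⊗₀ Z))
    α⇐ : ∀ {X Y Z} → (X ⊗₀ (Y ⊗₀ Z)) ⇒ ((X ⊗₀ Y) ⊗₀ Z)
    α-isoˡ : ∀ {X Y Z} → α⇐ {X} {Y} {Z} ∘ α⇒ ≈ id
    α-isoʳ : ∀ {X Y Z} → α⇒ {X} {Y} {Z} ∘ α⇐ ≈ id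
    α-natural : ∀ {X Y Z X′ Y′ Z′} {f : X ⇒ X′} {g : Y ⇒ Y′} {h : Z ⇒ Z′} →
                α⇒ ∘ ((f ⊗₁ g) ⊗₁ h) ≈ (f ⊗₁ (g ⊗₁ h)) ∘ α⇒
    λ⇒ : ∀ {X} → (I ⊗₀ X) ⇒ X
    λ⇐ : ∀ {X} → X ⇒ (I ⊗₀ X)
    λ-isoˡ : ∀ {X} → λ⇐ {X} ∘ λ⇒ ≈ id
    λ-isoʳ : ∀ {X} → λ⇒ {X} ∘ λ⇐ ≈ id
    λ-natural : ∀ {X Y} {f : X ⇒ Y} → λ⇒ ∘ (id ⊗₁ f) ≈ f ∘ λ⇒
    ρ⇒ : ∀ {X} → (X ⊗₀ I) ⇒ X
    ρ⇐ : ∀ {X} → X ⇒ (X ⊗₀ I)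
    ρ-isoˡ : ∀ {X} → ρ⇐ {X} ∘ ρ⇒ ≈ id
    ρ-isoʳ : ∀ {X} → ρ⇒ {X} ∘ ρ⇐ ≈ id
    ρ-natural : ∀ {X Y} {f : X ⇒ Y} → ρ⇒ ∘ (f ⊗₁ id) ≈ f ∘ ρ⇒
    pentagon : ∀ {W X Y Z} →
      α⇒ {W} {X} {Y ⊗₀ Z} ∘ α⇒ {W ⊗₀ X} {Y} {Z}
        ≈ (id ⊗₁ α⇒) ∘ α⇒ ∘ (α⇒ ⊗₁ id)
    triangle : ∀ {X Y} → (id {X} ⊗₁ λ⇒ {Y}) ∘ α⇒ ≈ ρ⇒ ⊗₁ id
    σ : ∀ {X Y} → (X ⊗₀ Y) ⇒ (Y ⊗₀ X)
    σ-natural : ∀ {X Y X′ Y′} {f : X ⇒ X′} {g : Y ⇒ Y′} →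
                σ ∘ (f ⊗₁ g) ≈ (g ⊗₁ f) ∘ σ
    σ-involutive : ∀ {X Y} → σ {Y} {X} ∘ σ {X} {Y} ≈ id
    hexagon : ∀ {X Y Z} →
      (id ⊗₁ σ) ∘ α⇒ ∘ (σ {X} {Y} ⊗₁ id {Z}) ≈ α⇒ ∘ σ {X} {Y ⊗₀ Z} ∘ α⇒

module _ {o ℓ e} (C : SymMonCat o ℓ e) where
  open SymMonCat C

  IsBij : ∀ {X Y X′ Y′} → (X ⇒ Y → X′ ⇒ Y′) → Set (ℓ ⊔ e)
  IsBij {X} {Y} {X′} {Y′} φ =
    (∀ {f g : X ⇒ Y} → φ f ≈ φ g → f ≈ g) ×
    (∀ (h : X′ ⇒ Y′) → Σ (X ⇒ Y) λ f → φ f ≈ h)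

  IsDualPairing : ∀ {A B Z} → (A ⊗₀ B) ⇒ Z → Set (o ⊔ ℓ ⊔ e)
  IsDualPairing {A} {B} {Z} ε =
    (∀ X → IsBij {X} {B} {A ⊗₀ X} {Z} (λ f → ε ∘ (id ⊗₁ f))) ×
    (∀ X → IsBij {X} {A} {X ⊗₀ B} {Z} (λ g → ε ∘ (g ⊗₁ id)))

  -- μ is associative (A⊗A⊗A read as (A⊗A)⊗A, associator inserted)
  IsAssociative : ∀ {A} → (A ⊗₀ A) ⇒ A → Set e
  IsAssociative μ = μ ∘ (μ ⊗₁ id) ≈ μ ∘ (id ⊗₁ μ) ∘ α⇒

  IsInducedLeft : ∀ {A B Z} → (A ⊗₀ B) ⇒ Z → (A ⊗₀ A) ⇒ A → (A ⊗₀ B) ⇒ B → Set e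
  IsInducedLeft ε μ ◁ = ε ∘ (id ⊗₁ ◁) ∘ α⇒ ≈ ε ∘ (μ ⊗₁ id)

  IsInducedRight : ∀ {A B Z} → (A ⊗₀ B) ⇒ Z → (A ⊗₀ A) ⇒ A → (B ⊗₀ A) ⇒ B → Set e
  IsInducedRight ε μ ▷ = ε ∘ (id ⊗₁ ▷) ∘ α⇒ ≈ ε ∘ (μ ⊗₁ id) ∘ α⇐ ∘ σ

-- Pairing with ε is injective in the B-variable, so an identity between maps into B can be
-- checked after applying ε ∘ (A ⊗ –), or ε ∘ σ ∘ (– ⊗ A) for the right action. There the
-- defining equations of ◁ and ▷ trade each action for a multiplication, and what remains is
-- associativity of μ up to the pentagon and hexagon coherences.
module Submission where

open import Relation.Binary using (IsEquivalence)
open import Data.Product using (_×_; _,_; proj₁)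
open import Defs

module SymMonCatProperties {o ℓ e} (C : SymMonCat o ℓ e) where
  open SymMonCat C

  ≈-refl : ∀ {X Y} {f : X ⇒ Y} → f ≈ f
  ≈-refl = IsEquivalence.refl ≈-equiv

  ≈-sym : ∀ {X Y} {f g : X ⇒ Y} → f ≈ g → g ≈ f
  ≈-sym = IsEquivalence.sym ≈-equiv

  ≈-trans : ∀ {X Y} {f g h : X ⇒ Y} → f ≈ g → g ≈ h → f ≈ h
  ≈-trans = IsEquivalence.trans ≈-equiv

  infixr 2 _≈⟨_⟩_
  infix 3 _∎

  _≈⟨_⟩_ : ∀ {X Y} (f : X ⇒ Y) {g h : X ⇒ Y} → f ≈ g → g ≈ h → f ≈ h
  _ ≈⟨ p ⟩ q = ≈-trans p q

  _∎ : ∀ {X Y} (f : X ⇒ Y) → f ≈ f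
  _ ∎ = ≈-refl

  infixr 4 refl⟩∘⟨_
  infixl 5 _⟩∘⟨refl

  refl⟩∘⟨_ : ∀ {X Y Z} {f : Y ⇒ Z} {g g′ : X ⇒ Y} → g ≈ g′ → f ∘ g ≈ f ∘ g′
  refl⟩∘⟨ p = ∘-resp-≈ ≈-refl p

  _⟩∘⟨refl : ∀ {X Y Z} {f f′ : Y ⇒ Z} {g : X ⇒ Y} → f ≈ f′ → f ∘ g ≈ f′ ∘ g
  p ⟩∘⟨refl = ∘-resp-≈ p ≈-refl

  sym-assoc : ∀ {W X Y Z} {f : Y ⇒ Z} {g : X ⇒ Y} {h : W ⇒ X} → f ∘ (g ∘ h) ≈ (f ∘ g) ∘ h
  sym-assoc = ≈-sym assoc

  sym-assoc² : ∀ {U V W X Y} {a : X ⇒ Y} {b : W ⇒ X} {c : V ⇒ W} {k : U ⇒ V} →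
               a ∘ (b ∘ (c ∘ k)) ≈ (a ∘ (b ∘ c)) ∘ k
  sym-assoc² = ≈-sym (≈-trans assoc (refl⟩∘⟨ assoc))

  assoc³ : ∀ {T U V W X Y} {a : X ⇒ Y} {b : W ⇒ X} {c : V ⇒ W} {d : U ⇒ V} {k : T ⇒ U} →
           (a ∘ (b ∘ (c ∘ d))) ∘ k ≈ a ∘ (b ∘ (c ∘ (d ∘ k)))
  assoc³ = ≈-trans assoc (refl⟩∘⟨ ≈-trans assoc (refl⟩∘⟨ assoc))

  assoc⁴ : ∀ {S T U V W X Y} {a : X ⇒ Y} {b : W ⇒ X} {c : V ⇒ W} {d : U ⇒ V}
             {f : T ⇒ U} {k : S ⇒ T} →
           (a ∘ (b ∘ (c ∘ (d ∘ f)))) ∘ k ≈ a ∘ (b ∘ (c ∘ (d ∘ (f ∘ k))))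
  assoc⁴ = ≈-trans assoc (refl⟩∘⟨ assoc³)

  pullˡ : ∀ {V W X Y} {f : X ⇒ Y} {g : W ⇒ X} {h : W ⇒ Y} {k : V ⇒ W} →
          f ∘ g ≈ h → f ∘ (g ∘ k) ≈ h ∘ k
  pullˡ p = ≈-trans sym-assoc (p ⟩∘⟨refl)

  pushˡ : ∀ {V W X Y} {f : X ⇒ Y} {g : W ⇒ X} {h : W ⇒ Y} {k : V ⇒ W} →
          h ≈ f ∘ g → h ∘ k ≈ f ∘ (g ∘ k)
  pushˡ p = ≈-sym (pullˡ (≈-sym p))

  extendˡ : ∀ {V W X X′ Y} {f : X ⇒ Y} {g : W ⇒ X} {f′ : X′ ⇒ Y} {g′ : W ⇒ X′} {k : V ⇒ W} →
            f ∘ g ≈ f′ ∘ g′ → f ∘ (g ∘ k) ≈ f′ ∘ (g′ ∘ k)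
  extendˡ p = ≈-trans (pullˡ p) assoc

  cancelˡ : ∀ {V W X} {f : X ⇒ W} {g : W ⇒ X} {k : V ⇒ W} → f ∘ g ≈ id → f ∘ (g ∘ k) ≈ k
  cancelˡ p = ≈-trans (pullˡ p) identityˡ

  insertˡ : ∀ {V W X} {f : X ⇒ W} {g : W ⇒ X} {k : V ⇒ W} → f ∘ g ≈ id → k ≈ f ∘ (g ∘ k)
  insertˡ p = ≈-sym (cancelˡ p)

  cancelʳ : ∀ {V W X} {f : W ⇒ V} {g : V ⇒ W} {h k : W ⇒ X} →
            g ∘ f ≈ id → h ∘ g ≈ k ∘ g → h ≈ k
  cancelʳ {f = f} {h = h} {k} p q =
    h                ≈⟨ ≈-sym (≈-trans (refl⟩∘⟨ p) identityʳ) ⟩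
    h ∘ (_ ∘ f)      ≈⟨ sym-assoc ⟩
    (h ∘ _) ∘ f      ≈⟨ q ⟩∘⟨refl ⟩
    (k ∘ _) ∘ f      ≈⟨ assoc ⟩
    k ∘ (_ ∘ f)      ≈⟨ ≈-trans (refl⟩∘⟨ p) identityʳ ⟩
    k ∎

  id⊗-∘ : ∀ {W X Y Z} {f : Y ⇒ Z} {g : X ⇒ Y} → id {W} ⊗₁ (f ∘ g) ≈ (id ⊗₁ f) ∘ (id ⊗₁ g)
  id⊗-∘ = ≈-trans (⊗-resp-≈ (≈-sym identityˡ) ≈-refl) ⊗-∘

  ⊗id-∘ : ∀ {W X Y Z} {f : Y ⇒ Z} {g : X ⇒ Y} → (f ∘ g) ⊗₁ id {W} ≈ (f ⊗₁ id) ∘ (g ⊗₁ id)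
  ⊗id-∘ = ≈-trans (⊗-resp-≈ ≈-refl (≈-sym identityˡ)) ⊗-∘

  ⊗id-inverse : ∀ {W X Y} {f : Y ⇒ X} {g : X ⇒ Y} →
                f ∘ g ≈ id → (f ⊗₁ id {W}) ∘ (g ⊗₁ id) ≈ id
  ⊗id-inverse p = ≈-trans (≈-sym ⊗-∘) (≈-trans (⊗-resp-≈ p identityˡ) ⊗-id)

  id⊗-inverse : ∀ {W X Y} {f : Y ⇒ X} {g : X ⇒ Y} →
                f ∘ g ≈ id → (id {W} ⊗₁ f) ∘ (id ⊗₁ g) ≈ id
  id⊗-inverse p = ≈-trans (≈-sym ⊗-∘) (≈-trans (⊗-resp-≈ identityˡ p) ⊗-id)

  ⊗-interchange : ∀ {X Y X′ Y′} {f : X ⇒ X′} {g : Y ⇒ Y′} →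
                  (f ⊗₁ id) ∘ (id ⊗₁ g) ≈ (id ⊗₁ g) ∘ (f ⊗₁ id)
  ⊗-interchange = ≈-trans (≈-sym ⊗-∘) (≈-trans (⊗-resp-≈ slide-f slide-g) ⊗-∘)
    where
    slide-f = ≈-trans identityʳ (≈-sym identityˡ)
    slide-g = ≈-trans identityˡ (≈-sym identityʳ)

  α⇐-natural : ∀ {X Y Z X′ Y′ Z′} {f : X ⇒ X′} {g : Y ⇒ Y′} {h : Z ⇒ Z′} →
               α⇐ ∘ (f ⊗₁ (g ⊗₁ h)) ≈ ((f ⊗₁ g) ⊗₁ h) ∘ α⇐
  α⇐-natural {f = f} {g} {h} =
    α⇐ ∘ (f ⊗₁ (g ⊗₁ h))                    ≈⟨ refl⟩∘⟨ ≈-trans (≈-sym identityʳ) (refl⟩∘⟨ ≈-sym α-isoʳ) ⟩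
    α⇐ ∘ ((f ⊗₁ (g ⊗₁ h)) ∘ (α⇒ ∘ α⇐))      ≈⟨ refl⟩∘⟨ ≈-trans sym-assoc (≈-sym α-natural ⟩∘⟨refl) ⟩
    α⇐ ∘ ((α⇒ ∘ ((f ⊗₁ g) ⊗₁ h)) ∘ α⇐)      ≈⟨ refl⟩∘⟨ assoc ⟩
    α⇐ ∘ (α⇒ ∘ (((f ⊗₁ g) ⊗₁ h) ∘ α⇐))      ≈⟨ cancelˡ α-isoˡ ⟩
    ((f ⊗₁ g) ⊗₁ h) ∘ α⇐ ∎

  α⇐-natural₁ : ∀ {X Y Z X′} {f : X ⇒ X′} → α⇐ ∘ (f ⊗₁ id {Y ⊗₀ Z}) ≈ ((f ⊗₁ id) ⊗₁ id) ∘ α⇐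
  α⇐-natural₁ = ≈-trans (refl⟩∘⟨ ⊗-resp-≈ ≈-refl (≈-sym ⊗-id)) α⇐-natural

  α⇐-natural₃ : ∀ {X Y Z Z′} {h : Z ⇒ Z′} → α⇐ ∘ (id {X} ⊗₁ (id {Y} ⊗₁ h)) ≈ (id ⊗₁ h) ∘ α⇐
  α⇐-natural₃ = ≈-trans α⇐-natural (⊗-resp-≈ ⊗-id ≈-refl ⟩∘⟨refl)

  pentagon⇐ : ∀ {W X Y Z} → α⇐ {W ⊗₀ X} {Y} {Z} ∘ α⇐ ≈ (α⇐ ⊗₁ id) ∘ (α⇐ ∘ (id ⊗₁ α⇐))
  pentagon⇐ = ≈-sym (
    (α⇐ ⊗₁ id) ∘ (α⇐ ∘ (id ⊗₁ α⇐))
      ≈⟨ insertˡ α-isoˡ ⟩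
    α⇐ ∘ (α⇒ ∘ ((α⇐ ⊗₁ id) ∘ (α⇐ ∘ (id ⊗₁ α⇐))))
      ≈⟨ refl⟩∘⟨ insertˡ α-isoˡ ⟩
    α⇐ ∘ (α⇐ ∘ (α⇒ ∘ (α⇒ ∘ ((α⇐ ⊗₁ id) ∘ (α⇐ ∘ (id ⊗₁ α⇐))))))
      ≈⟨ refl⟩∘⟨ refl⟩∘⟨ pentagon-inverse ⟩
    α⇐ ∘ (α⇐ ∘ id)
      ≈⟨ refl⟩∘⟨ identityʳ ⟩
    α⇐ ∘ α⇐ ∎)
    where
    pentagon-inverse : α⇒ ∘ (α⇒ ∘ ((α⇐ ⊗₁ id) ∘ (α⇐ ∘ (id ⊗₁ α⇐)))) ≈ id
    pentagon-inverse =
      ≈-trans (pullˡ pentagon)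
      (≈-trans (≈-trans assoc (refl⟩∘⟨ assoc))
      (≈-trans (refl⟩∘⟨ refl⟩∘⟨ cancelˡ (⊗id-inverse α-isoʳ))
      (≈-trans (refl⟩∘⟨ cancelˡ α-isoʳ) (id⊗-inverse α-isoʳ))))

  pentagon⇐-α⇒ʳ : ∀ {W X Y Z} → α⇐ {W ⊗₀ X} {Y} {Z} ∘ (α⇐ ∘ (id ⊗₁ α⇒)) ≈ (α⇐ ⊗₁ id) ∘ α⇐
  pentagon⇐-α⇒ʳ =
    ≈-trans (pullˡ pentagon⇐)
    (≈-trans (≈-trans assoc (refl⟩∘⟨ assoc))
    (refl⟩∘⟨ ≈-trans (refl⟩∘⟨ id⊗-inverse α-isoˡ) identityʳ))

  pentagon⇐-α⇒ˡ : ∀ {V W X Y Z} {k : V ⇒ (W ⊗₀ (X ⊗₀ (Y ⊗₀ Z)))} →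
                  (α⇒ ⊗₁ id) ∘ (α⇐ ∘ (α⇐ ∘ k)) ≈ α⇐ ∘ ((id ⊗₁ α⇐) ∘ k)
  pentagon⇐-α⇒ˡ =
    ≈-trans (refl⟩∘⟨ sym-assoc)
    (≈-trans (pullˡ (≈-trans (refl⟩∘⟨ pentagon⇐) (cancelˡ (⊗id-inverse α-isoʳ)))) assoc)

  σ-unfoldʳ : ∀ {X Y Z} → σ {X} {Y ⊗₀ Z} ≈ α⇐ ∘ ((id ⊗₁ σ) ∘ (α⇒ ∘ ((σ ⊗₁ id) ∘ α⇐)))
  σ-unfoldʳ = ≈-sym (
    ≈-trans (refl⟩∘⟨ sym-assoc²) (≈-trans (refl⟩∘⟨ (hexagon ⟩∘⟨refl))
    (≈-trans (refl⟩∘⟨ ≈-trans assoc (refl⟩∘⟨ ≈-trans assoc (refl⟩∘⟨ α-isoʳ)))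
    (≈-trans (refl⟩∘⟨ refl⟩∘⟨ identityʳ) (cancelˡ α-isoˡ)))))

  -- The other hexagon is not an axiom: it follows by conjugating σ-unfoldʳ with σ.
  σ-unfoldˡ : ∀ {X Y Z} → σ {X ⊗₀ Y} {Z} ≈ α⇒ ∘ ((σ ⊗₁ id) ∘ (α⇐ ∘ ((id ⊗₁ σ) ∘ α⇒)))
  σ-unfoldˡ {X} {Y} {Z} =
    σ              ≈⟨ ≈-sym identityʳ ⟩
    σ ∘ id         ≈⟨ refl⟩∘⟨ ≈-sym σ∘unfolded≈id ⟩
    σ ∘ (σ ∘ unfolded) ≈⟨ pullˡ σ-involutive ⟩
    id ∘ unfolded  ≈⟨ identityˡ ⟩
    unfolded ∎
    where
    unfolded = α⇒ ∘ ((σ ⊗₁ id) ∘ (α⇐ ∘ ((id ⊗₁ σ) ∘ α⇒)))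
    σ∘unfolded≈id : σ {Z} {X ⊗₀ Y} ∘ unfolded ≈ id
    σ∘unfolded≈id =
      ≈-trans (σ-unfoldʳ ⟩∘⟨refl) (≈-trans assoc⁴
      (≈-trans (refl⟩∘⟨ refl⟩∘⟨ refl⟩∘⟨ refl⟩∘⟨ cancelˡ α-isoˡ)
      (≈-trans (refl⟩∘⟨ refl⟩∘⟨ refl⟩∘⟨ cancelˡ (⊗id-inverse σ-involutive))
      (≈-trans (refl⟩∘⟨ refl⟩∘⟨ cancelˡ α-isoʳ)
      (≈-trans (refl⟩∘⟨ cancelˡ (id⊗-inverse σ-involutive)) α-isoˡ)))))

  -- Two presentations of the cyclic permutation (X ⊗ Y) ⊗ Z → (Y ⊗ Z) ⊗ X.
  σ-rotate : ∀ {X Y Z} → α⇐ ∘ (σ {Z ⊗₀ X} {Y} ∘ (α⇐ ∘ σ {X ⊗₀ Y} {Z})) ≈ σ {X} {Y ⊗₀ Z} ∘ α⇒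
  σ-rotate {X} {Y} {Z} =
    α⇐ ∘ (σ ∘ (α⇐ ∘ σ))
      ≈⟨ refl⟩∘⟨ (σ-unfoldˡ {Z} {X} {Y} ⟩∘⟨refl) ⟩
    α⇐ ∘ ((α⇒ ∘ ((σ ⊗₁ id) ∘ (α⇐ ∘ ((id ⊗₁ σ) ∘ α⇒)))) ∘ (α⇐ ∘ σ))
      ≈⟨ refl⟩∘⟨ assoc⁴ ⟩
    α⇐ ∘ (α⇒ ∘ ((σ ⊗₁ id) ∘ (α⇐ ∘ ((id ⊗₁ σ) ∘ (α⇒ ∘ (α⇐ ∘ σ))))))
      ≈⟨ cancelˡ α-isoˡ ⟩
    (σ ⊗₁ id) ∘ (α⇐ ∘ ((id ⊗₁ σ) ∘ (α⇒ ∘ (α⇐ ∘ σ))))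
      ≈⟨ refl⟩∘⟨ refl⟩∘⟨ refl⟩∘⟨ cancelˡ α-isoʳ ⟩
    (σ ⊗₁ id) ∘ (α⇐ ∘ ((id ⊗₁ σ) ∘ σ))
      ≈⟨ refl⟩∘⟨ refl⟩∘⟨ ≈-sym σ-natural ⟩
    (σ ⊗₁ id) ∘ (α⇐ ∘ (σ ∘ (σ ⊗₁ id)))
      ≈⟨ refl⟩∘⟨ refl⟩∘⟨ (σ-unfoldˡ {Y} {X} {Z} ⟩∘⟨refl) ⟩
    (σ ⊗₁ id) ∘ (α⇐ ∘ ((α⇒ ∘ ((σ ⊗₁ id) ∘ (α⇐ ∘ ((id ⊗₁ σ) ∘ α⇒)))) ∘ (σ ⊗₁ id)))
      ≈⟨ refl⟩∘⟨ refl⟩∘⟨ assoc⁴ ⟩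
    (σ ⊗₁ id) ∘ (α⇐ ∘ (α⇒ ∘ ((σ ⊗₁ id) ∘ (α⇐ ∘ ((id ⊗₁ σ) ∘ (α⇒ ∘ (σ ⊗₁ id)))))))
      ≈⟨ refl⟩∘⟨ cancelˡ α-isoˡ ⟩
    (σ ⊗₁ id) ∘ ((σ ⊗₁ id) ∘ (α⇐ ∘ ((id ⊗₁ σ) ∘ (α⇒ ∘ (σ ⊗₁ id)))))
      ≈⟨ cancelˡ (⊗id-inverse σ-involutive) ⟩
    α⇐ ∘ ((id ⊗₁ σ) ∘ (α⇒ ∘ (σ ⊗₁ id)))
      ≈⟨ ≈-sym (refl⟩∘⟨ refl⟩∘⟨ refl⟩∘⟨ ≈-trans (refl⟩∘⟨ α-isoˡ) identityʳ) ⟩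
    α⇐ ∘ ((id ⊗₁ σ) ∘ (α⇒ ∘ ((σ ⊗₁ id) ∘ (α⇐ ∘ α⇒))))
      ≈⟨ ≈-sym assoc⁴ ⟩
    (α⇐ ∘ ((id ⊗₁ σ) ∘ (α⇒ ∘ ((σ ⊗₁ id) ∘ α⇐)))) ∘ α⇒
      ≈⟨ ≈-sym σ-unfoldʳ ⟩∘⟨refl ⟩
    σ ∘ α⇒ ∎

module DualPairingProperties {o ℓ e} (C : SymMonCat o ℓ e) where
  open SymMonCat C
  open SymMonCatProperties C

  module _ {A B Z : Obj} {ε : (A ⊗₀ B) ⇒ Z} (dp : IsDualPairing C ε) where

    pairing-cancel : ∀ {X} {f g : X ⇒ B} → ε ∘ (id ⊗₁ f) ≈ ε ∘ (id ⊗₁ g) → f ≈ g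
    pairing-cancel {X} = proj₁ (proj₁ dp X)

    pairing-cancel-σ : ∀ {X} {f g : X ⇒ B} →
                       ε ∘ (σ ∘ (f ⊗₁ id)) ≈ ε ∘ (σ ∘ (g ⊗₁ id)) → f ≈ g
    pairing-cancel-σ {f = f} {g} p =
      pairing-cancel (cancelʳ σ-involutive
        (≈-trans (≈-sym (slide-σ f)) (≈-trans p (slide-σ g))))
      where
      slide-σ : ∀ h → ε ∘ (σ ∘ (h ⊗₁ id)) ≈ (ε ∘ (id ⊗₁ h)) ∘ σ
      slide-σ h = ≈-trans (refl⟩∘⟨ σ-natural) sym-assoc

module InducedActions {o ℓ e} (C : SymMonCat o ℓ e) where
  open SymMonCat C
  open SymMonCatProperties C
  open DualPairingProperties C

  module Laws {A B Z : Obj} (ε : (A ⊗₀ B) ⇒ Z) (dp : IsDualPairing C ε)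
    (μ : (A ⊗₀ A) ⇒ A) (◁ : (A ⊗₀ B) ⇒ B) (▷ : (B ⊗₀ A) ⇒ B)
    (◁-induced : IsInducedLeft C ε μ ◁) (▷-induced : IsInducedRight C ε μ ▷) where

    ◁-transpose : ∀ {X} {k : X ⇒ (A ⊗₀ (A ⊗₀ B))} →
                  ε ∘ ((id ⊗₁ ◁) ∘ k) ≈ ε ∘ ((μ ⊗₁ id) ∘ (α⇐ ∘ k))
    ◁-transpose = ≈-trans (refl⟩∘⟨ refl⟩∘⟨ insertˡ α-isoʳ)
                  (≈-trans sym-assoc² (≈-trans (◁-induced ⟩∘⟨refl) assoc))

    ▷-transpose : ∀ {X} {k : X ⇒ (A ⊗₀ (B ⊗₀ A))} →
                  ε ∘ ((id ⊗₁ ▷) ∘ k) ≈ ε ∘ ((μ ⊗₁ id) ∘ (α⇐ ∘ (σ ∘ (α⇐ ∘ k))))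
    ▷-transpose = ≈-trans (refl⟩∘⟨ refl⟩∘⟨ insertˡ α-isoʳ)
                  (≈-trans sym-assoc² (≈-trans (▷-induced ⟩∘⟨refl) assoc³))

    ▷-transpose-σ : ∀ {X} {k : X ⇒ ((B ⊗₀ A) ⊗₀ A)} →
                    ε ∘ (σ ∘ ((▷ ⊗₁ id) ∘ k)) ≈ ε ∘ (σ ∘ ((id ⊗₁ μ) ∘ (α⇒ ∘ k)))
    ▷-transpose-σ {k = k} =
      ε ∘ (σ ∘ ((▷ ⊗₁ id) ∘ k))                        ≈⟨ refl⟩∘⟨ pullˡ σ-natural ⟩
      ε ∘ (((id ⊗₁ ▷) ∘ σ) ∘ k)                        ≈⟨ refl⟩∘⟨ assoc ⟩
      ε ∘ ((id ⊗₁ ▷) ∘ (σ ∘ k))                        ≈⟨ ▷-transpose ⟩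
      ε ∘ ((μ ⊗₁ id) ∘ (α⇐ ∘ (σ ∘ (α⇐ ∘ (σ ∘ k)))))    ≈⟨ refl⟩∘⟨ refl⟩∘⟨ ≈-sym assoc³ ⟩
      ε ∘ ((μ ⊗₁ id) ∘ ((α⇐ ∘ (σ ∘ (α⇐ ∘ σ))) ∘ k))    ≈⟨ refl⟩∘⟨ refl⟩∘⟨ (σ-rotate ⟩∘⟨refl) ⟩
      ε ∘ ((μ ⊗₁ id) ∘ ((σ ∘ α⇒) ∘ k))                 ≈⟨ refl⟩∘⟨ refl⟩∘⟨ assoc ⟩
      ε ∘ ((μ ⊗₁ id) ∘ (σ ∘ (α⇒ ∘ k)))                 ≈⟨ refl⟩∘⟨ pullˡ (≈-sym σ-natural) ⟩
      ε ∘ ((σ ∘ (id ⊗₁ μ)) ∘ (α⇒ ∘ k))                 ≈⟨ refl⟩∘⟨ assoc ⟩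
      ε ∘ (σ ∘ ((id ⊗₁ μ) ∘ (α⇒ ∘ k))) ∎

    ▷-◁-pairing : ε ∘ (id ⊗₁ ▷) ∘ α⇒ ≈ ε ∘ σ ∘ (◁ ⊗₁ id)
    ▷-◁-pairing =
      ε ∘ ((id ⊗₁ ▷) ∘ α⇒)        ≈⟨ ▷-induced ⟩
      ε ∘ ((μ ⊗₁ id) ∘ (α⇐ ∘ σ))  ≈⟨ ≈-sym ◁-transpose ⟩
      ε ∘ ((id ⊗₁ ◁) ∘ σ)         ≈⟨ refl⟩∘⟨ ≈-sym σ-natural ⟩
      ε ∘ (σ ∘ (◁ ⊗₁ id)) ∎

    ◁∘▷-transpose : ε ∘ (id ⊗₁ (◁ ∘ ((id ⊗₁ ▷) ∘ α⇒)))
                    ≈ ε ∘ (((μ ∘ (id ⊗₁ μ)) ⊗₁ id) ∘ (α⇐ ∘ (σ ∘ ((α⇐ ⊗₁ id) ∘ α⇐))))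
    ◁∘▷-transpose =
      ε ∘ (id ⊗₁ (◁ ∘ ((id ⊗₁ ▷) ∘ α⇒)))
        ≈⟨ refl⟩∘⟨ ≈-trans id⊗-∘ (refl⟩∘⟨ id⊗-∘) ⟩
      ε ∘ ((id ⊗₁ ◁) ∘ ((id ⊗₁ (id ⊗₁ ▷)) ∘ (id ⊗₁ α⇒)))
        ≈⟨ ◁-transpose ⟩
      ε ∘ ((μ ⊗₁ id) ∘ (α⇐ ∘ ((id ⊗₁ (id ⊗₁ ▷)) ∘ (id ⊗₁ α⇒))))
        ≈⟨ refl⟩∘⟨ refl⟩∘⟨ extendˡ α⇐-natural₃ ⟩
      ε ∘ ((μ ⊗₁ id) ∘ ((id ⊗₁ ▷) ∘ (α⇐ ∘ (id ⊗₁ α⇒))))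
        ≈⟨ refl⟩∘⟨ extendˡ ⊗-interchange ⟩
      ε ∘ ((id ⊗₁ ▷) ∘ ((μ ⊗₁ id) ∘ (α⇐ ∘ (id ⊗₁ α⇒))))
        ≈⟨ ▷-transpose ⟩
      ε ∘ ((μ ⊗₁ id) ∘ (α⇐ ∘ (σ ∘ (α⇐ ∘ ((μ ⊗₁ id) ∘ (α⇐ ∘ (id ⊗₁ α⇒)))))))
        ≈⟨ refl⟩∘⟨ refl⟩∘⟨ refl⟩∘⟨ refl⟩∘⟨ extendˡ α⇐-natural₁ ⟩
      ε ∘ ((μ ⊗₁ id) ∘ (α⇐ ∘ (σ ∘ (((μ ⊗₁ id) ⊗₁ id) ∘ (α⇐ ∘ (α⇐ ∘ (id ⊗₁ α⇒)))))))
        ≈⟨ refl⟩∘⟨ refl⟩∘⟨ refl⟩∘⟨ extendˡ σ-natural ⟩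
      ε ∘ ((μ ⊗₁ id) ∘ (α⇐ ∘ ((id ⊗₁ (μ ⊗₁ id)) ∘ (σ ∘ (α⇐ ∘ (α⇐ ∘ (id ⊗₁ α⇒)))))))
        ≈⟨ refl⟩∘⟨ refl⟩∘⟨ extendˡ α⇐-natural ⟩
      ε ∘ ((μ ⊗₁ id) ∘ (((id ⊗₁ μ) ⊗₁ id) ∘ (α⇐ ∘ (σ ∘ (α⇐ ∘ (α⇐ ∘ (id ⊗₁ α⇒)))))))
        ≈⟨ refl⟩∘⟨ pullˡ (≈-sym ⊗id-∘) ⟩
      ε ∘ (((μ ∘ (id ⊗₁ μ)) ⊗₁ id) ∘ (α⇐ ∘ (σ ∘ (α⇐ ∘ (α⇐ ∘ (id ⊗₁ α⇒))))))
        ≈⟨ refl⟩∘⟨ refl⟩∘⟨ refl⟩∘⟨ refl⟩∘⟨ pentagon⇐-α⇒ʳ ⟩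
      ε ∘ (((μ ∘ (id ⊗₁ μ)) ⊗₁ id) ∘ (α⇐ ∘ (σ ∘ ((α⇐ ⊗₁ id) ∘ α⇐)))) ∎

    ▷∘◁-transpose : ε ∘ (id ⊗₁ (▷ ∘ (◁ ⊗₁ id)))
                    ≈ ε ∘ (((μ ∘ (μ ⊗₁ id)) ⊗₁ id) ∘ (α⇐ ∘ (α⇐ ∘ (σ ∘ α⇐))))
    ▷∘◁-transpose =
      ε ∘ (id ⊗₁ (▷ ∘ (◁ ⊗₁ id)))
        ≈⟨ refl⟩∘⟨ id⊗-∘ ⟩
      ε ∘ ((id ⊗₁ ▷) ∘ (id ⊗₁ (◁ ⊗₁ id)))
        ≈⟨ ▷-transpose ⟩
      ε ∘ ((μ ⊗₁ id) ∘ (α⇐ ∘ (σ ∘ (α⇐ ∘ (id ⊗₁ (◁ ⊗₁ id))))))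
        ≈⟨ refl⟩∘⟨ refl⟩∘⟨ refl⟩∘⟨ refl⟩∘⟨ α⇐-natural ⟩
      ε ∘ ((μ ⊗₁ id) ∘ (α⇐ ∘ (σ ∘ (((id ⊗₁ ◁) ⊗₁ id) ∘ α⇐))))
        ≈⟨ refl⟩∘⟨ refl⟩∘⟨ refl⟩∘⟨ extendˡ σ-natural ⟩
      ε ∘ ((μ ⊗₁ id) ∘ (α⇐ ∘ ((id ⊗₁ (id ⊗₁ ◁)) ∘ (σ ∘ α⇐))))
        ≈⟨ refl⟩∘⟨ refl⟩∘⟨ extendˡ α⇐-natural₃ ⟩
      ε ∘ ((μ ⊗₁ id) ∘ ((id ⊗₁ ◁) ∘ (α⇐ ∘ (σ ∘ α⇐))))
        ≈⟨ refl⟩∘⟨ extendˡ ⊗-interchange ⟩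
      ε ∘ ((id ⊗₁ ◁) ∘ ((μ ⊗₁ id) ∘ (α⇐ ∘ (σ ∘ α⇐))))
        ≈⟨ ◁-transpose ⟩
      ε ∘ ((μ ⊗₁ id) ∘ (α⇐ ∘ ((μ ⊗₁ id) ∘ (α⇐ ∘ (σ ∘ α⇐)))))
        ≈⟨ refl⟩∘⟨ refl⟩∘⟨ extendˡ α⇐-natural₁ ⟩
      ε ∘ ((μ ⊗₁ id) ∘ (((μ ⊗₁ id) ⊗₁ id) ∘ (α⇐ ∘ (α⇐ ∘ (σ ∘ α⇐)))))
        ≈⟨ refl⟩∘⟨ pullˡ (≈-sym ⊗id-∘) ⟩
      ε ∘ (((μ ∘ (μ ⊗₁ id)) ⊗₁ id) ∘ (α⇐ ∘ (α⇐ ∘ (σ ∘ α⇐)))) ∎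

    module _ (μ-assoc : IsAssociative C μ) where

      μ-assoc⊗id : (μ ∘ (μ ⊗₁ id)) ⊗₁ id {B} ≈ ((μ ∘ (id ⊗₁ μ)) ⊗₁ id) ∘ (α⇒ ⊗₁ id)
      μ-assoc⊗id = ≈-trans (⊗-resp-≈ (≈-trans μ-assoc sym-assoc) ≈-refl) ⊗id-∘

      ◁-action : ◁ ∘ (μ ⊗₁ id) ≈ ◁ ∘ (id ⊗₁ ◁) ∘ α⇒
      ◁-action = pairing-cancel dp (
        ε ∘ (id ⊗₁ (◁ ∘ (μ ⊗₁ id)))                      ≈⟨ refl⟩∘⟨ id⊗-∘ ⟩
        ε ∘ ((id ⊗₁ ◁) ∘ (id ⊗₁ (μ ⊗₁ id)))              ≈⟨ ◁-transpose ⟩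
        ε ∘ ((μ ⊗₁ id) ∘ (α⇐ ∘ (id ⊗₁ (μ ⊗₁ id))))       ≈⟨ refl⟩∘⟨ refl⟩∘⟨ α⇐-natural ⟩
        ε ∘ ((μ ⊗₁ id) ∘ (((id ⊗₁ μ) ⊗₁ id) ∘ α⇐))       ≈⟨ refl⟩∘⟨ pullˡ (≈-sym ⊗id-∘) ⟩
        ε ∘ (((μ ∘ (id ⊗₁ μ)) ⊗₁ id) ∘ α⇐)               ≈⟨ refl⟩∘⟨ refl⟩∘⟨ ≈-sym α⇐-conjugate ⟩
        ε ∘ (((μ ∘ (id ⊗₁ μ)) ⊗₁ id) ∘ ((α⇒ ⊗₁ id) ∘ (α⇐ ∘ (α⇐ ∘ (id ⊗₁ α⇒)))))
          ≈⟨ refl⟩∘⟨ pullˡ (≈-sym μ-assoc⊗id) ⟩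
        ε ∘ (((μ ∘ (μ ⊗₁ id)) ⊗₁ id) ∘ (α⇐ ∘ (α⇐ ∘ (id ⊗₁ α⇒))))
          ≈⟨ refl⟩∘⟨ pushˡ ⊗id-∘ ⟩
        ε ∘ ((μ ⊗₁ id) ∘ (((μ ⊗₁ id) ⊗₁ id) ∘ (α⇐ ∘ (α⇐ ∘ (id ⊗₁ α⇒)))))
          ≈⟨ refl⟩∘⟨ refl⟩∘⟨ extendˡ (≈-sym α⇐-natural₁) ⟩
        ε ∘ ((μ ⊗₁ id) ∘ (α⇐ ∘ ((μ ⊗₁ id) ∘ (α⇐ ∘ (id ⊗₁ α⇒)))))
          ≈⟨ ≈-sym ◁-transpose ⟩
        ε ∘ ((id ⊗₁ ◁) ∘ ((μ ⊗₁ id) ∘ (α⇐ ∘ (id ⊗₁ α⇒))))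
          ≈⟨ refl⟩∘⟨ extendˡ (≈-sym ⊗-interchange) ⟩
        ε ∘ ((μ ⊗₁ id) ∘ ((id ⊗₁ ◁) ∘ (α⇐ ∘ (id ⊗₁ α⇒))))
          ≈⟨ refl⟩∘⟨ refl⟩∘⟨ extendˡ (≈-sym α⇐-natural₃) ⟩
        ε ∘ ((μ ⊗₁ id) ∘ (α⇐ ∘ ((id ⊗₁ (id ⊗₁ ◁)) ∘ (id ⊗₁ α⇒))))
          ≈⟨ ≈-sym ◁-transpose ⟩
        ε ∘ ((id ⊗₁ ◁) ∘ ((id ⊗₁ (id ⊗₁ ◁)) ∘ (id ⊗₁ α⇒))) ≈⟨ refl⟩∘⟨ refl⟩∘⟨ ≈-sym id⊗-∘ ⟩
        ε ∘ ((id ⊗₁ ◁) ∘ (id ⊗₁ ((id ⊗₁ ◁) ∘ α⇒)))         ≈⟨ refl⟩∘⟨ ≈-sym id⊗-∘ ⟩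
        ε ∘ (id ⊗₁ (◁ ∘ ((id ⊗₁ ◁) ∘ α⇒))) ∎)
        where
        α⇐-conjugate : (α⇒ ⊗₁ id) ∘ (α⇐ ∘ (α⇐ ∘ (id ⊗₁ α⇒))) ≈ α⇐ {A} {A ⊗₀ A} {B}
        α⇐-conjugate = ≈-trans pentagon⇐-α⇒ˡ (≈-trans (refl⟩∘⟨ id⊗-inverse α-isoˡ) identityʳ)

      ▷-action : ▷ ∘ (id ⊗₁ μ) ∘ α⇒ ≈ ▷ ∘ (▷ ⊗₁ id)
      ▷-action = pairing-cancel-σ dp (
        ε ∘ (σ ∘ ((▷ ∘ ((id ⊗₁ μ) ∘ α⇒)) ⊗₁ id))
          ≈⟨ refl⟩∘⟨ refl⟩∘⟨ ≈-trans ⊗id-∘ (refl⟩∘⟨ ⊗id-∘) ⟩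
        ε ∘ (σ ∘ ((▷ ⊗₁ id) ∘ (((id ⊗₁ μ) ⊗₁ id) ∘ (α⇒ ⊗₁ id))))
          ≈⟨ ▷-transpose-σ ⟩
        ε ∘ (σ ∘ ((id ⊗₁ μ) ∘ (α⇒ ∘ (((id ⊗₁ μ) ⊗₁ id) ∘ (α⇒ ⊗₁ id)))))
          ≈⟨ refl⟩∘⟨ refl⟩∘⟨ refl⟩∘⟨ extendˡ α-natural ⟩
        ε ∘ (σ ∘ ((id ⊗₁ μ) ∘ ((id ⊗₁ (μ ⊗₁ id)) ∘ (α⇒ ∘ (α⇒ ⊗₁ id)))))
          ≈⟨ refl⟩∘⟨ refl⟩∘⟨ pullˡ (≈-sym id⊗-∘) ⟩
        ε ∘ (σ ∘ ((id ⊗₁ (μ ∘ (μ ⊗₁ id))) ∘ (α⇒ ∘ (α⇒ ⊗₁ id))))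
          ≈⟨ refl⟩∘⟨ refl⟩∘⟨ (≈-trans (⊗-resp-≈ ≈-refl μ-assoc) (≈-trans id⊗-∘ (refl⟩∘⟨ id⊗-∘)) ⟩∘⟨refl) ⟩
        ε ∘ (σ ∘ (((id ⊗₁ μ) ∘ ((id ⊗₁ (id ⊗₁ μ)) ∘ (id ⊗₁ α⇒))) ∘ (α⇒ ∘ (α⇒ ⊗₁ id))))
          ≈⟨ refl⟩∘⟨ refl⟩∘⟨ ≈-trans assoc (refl⟩∘⟨ assoc) ⟩
        ε ∘ (σ ∘ ((id ⊗₁ μ) ∘ ((id ⊗₁ (id ⊗₁ μ)) ∘ ((id ⊗₁ α⇒) ∘ (α⇒ ∘ (α⇒ ⊗₁ id))))))
          ≈⟨ refl⟩∘⟨ refl⟩∘⟨ refl⟩∘⟨ refl⟩∘⟨ ≈-sym pentagon ⟩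
        ε ∘ (σ ∘ ((id ⊗₁ μ) ∘ ((id ⊗₁ (id ⊗₁ μ)) ∘ (α⇒ ∘ α⇒))))
          ≈⟨ refl⟩∘⟨ refl⟩∘⟨ refl⟩∘⟨ extendˡ (≈-trans (≈-sym α-natural) (refl⟩∘⟨ ⊗-resp-≈ ⊗-id ≈-refl)) ⟩
        ε ∘ (σ ∘ ((id ⊗₁ μ) ∘ (α⇒ ∘ ((id ⊗₁ μ) ∘ α⇒))))
          ≈⟨ ≈-sym ▷-transpose-σ ⟩
        ε ∘ (σ ∘ ((▷ ⊗₁ id) ∘ ((id ⊗₁ μ) ∘ α⇒)))
          ≈⟨ refl⟩∘⟨ refl⟩∘⟨ extendˡ ⊗-interchange ⟩
        ε ∘ (σ ∘ ((id ⊗₁ μ) ∘ ((▷ ⊗₁ id) ∘ α⇒)))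
          ≈⟨ refl⟩∘⟨ refl⟩∘⟨ refl⟩∘⟨ ≈-trans (⊗-resp-≈ ≈-refl (≈-sym ⊗-id) ⟩∘⟨refl) (≈-sym α-natural) ⟩
        ε ∘ (σ ∘ ((id ⊗₁ μ) ∘ (α⇒ ∘ ((▷ ⊗₁ id) ⊗₁ id))))
          ≈⟨ ≈-sym ▷-transpose-σ ⟩
        ε ∘ (σ ∘ ((▷ ⊗₁ id) ∘ ((▷ ⊗₁ id) ⊗₁ id)))
          ≈⟨ refl⟩∘⟨ refl⟩∘⟨ ≈-sym ⊗id-∘ ⟩
        ε ∘ (σ ∘ ((▷ ∘ (▷ ⊗₁ id)) ⊗₁ id)) ∎)

      ◁-▷-commute : ◁ ∘ (id ⊗₁ ▷) ∘ α⇒ ≈ ▷ ∘ (◁ ⊗₁ id)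
      ◁-▷-commute = pairing-cancel dp (
        ε ∘ (id ⊗₁ (◁ ∘ ((id ⊗₁ ▷) ∘ α⇒)))
          ≈⟨ ◁∘▷-transpose ⟩
        ε ∘ (((μ ∘ (id ⊗₁ μ)) ⊗₁ id) ∘ (α⇐ ∘ (σ ∘ ((α⇐ ⊗₁ id) ∘ α⇐))))
          ≈⟨ refl⟩∘⟨ refl⟩∘⟨ refl⟩∘⟨ extendˡ σ-natural ⟩
        ε ∘ (((μ ∘ (id ⊗₁ μ)) ⊗₁ id) ∘ (α⇐ ∘ ((id ⊗₁ α⇐) ∘ (σ ∘ α⇐))))
          ≈⟨ refl⟩∘⟨ refl⟩∘⟨ ≈-sym pentagon⇐-α⇒ˡ ⟩
        ε ∘ (((μ ∘ (id ⊗₁ μ)) ⊗₁ id) ∘ ((α⇒ ⊗₁ id) ∘ (α⇐ ∘ (α⇐ ∘ (σ ∘ α⇐)))))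
          ≈⟨ refl⟩∘⟨ pullˡ (≈-sym μ-assoc⊗id) ⟩
        ε ∘ (((μ ∘ (μ ⊗₁ id)) ⊗₁ id) ∘ (α⇐ ∘ (α⇐ ∘ (σ ∘ α⇐))))
          ≈⟨ ≈-sym ▷∘◁-transpose ⟩
        ε ∘ (id ⊗₁ (▷ ∘ (◁ ⊗₁ id))) ∎)

mainTheorem13 : ∀ {o ℓ e} (C : SymMonCat o ℓ e) →
    let open SymMonCat C in
    ∀ {A B Z : Obj} (ε : (A ⊗₀ B) ⇒ Z) → IsDualPairing C ε →
    (μ : (A ⊗₀ A) ⇒ A) (◁ : (A ⊗₀ B) ⇒ B) (▷ : (B ⊗₀ A) ⇒ B) →
    IsInducedLeft C ε μ ◁ → IsInducedRight C ε μ ▷ →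
    (ε ∘ (id ⊗₁ ▷) ∘ α⇒ ≈ ε ∘ σ ∘ (◁ ⊗₁ id))
    × (IsAssociative C μ →
         (◁ ∘ (μ ⊗₁ id) ≈ ◁ ∘ (id ⊗₁ ◁) ∘ α⇒)
         × (▷ ∘ (id ⊗₁ μ) ∘ α⇒ ≈ ▷ ∘ (▷ ⊗₁ id)))
    × (IsAssociative C μ → ◁ ∘ (id ⊗₁ ▷) ∘ α⇒ ≈ ▷ ∘ (◁ ⊗₁ id))
mainTheorem13 C ε dp μ ◁ ▷ ◁-induced ▷-induced =
    ▷-◁-pairing
  , (λ μ-assoc → ◁-action μ-assoc , ▷-action μ-assoc)
  , ◁-▷-commute
  where open InducedActions.Laws C ε dp μ ◁ ▷ ◁-induced ▷-induced
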